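{- Let $t\geq 5$ be an integer, let $d$ be a positive integer, let $(T,B)$ be a canonical territory and let $x,y\in V(B)$ be such that $\mathrm{dist}_T(x,y)\leq d$. Then $\mathrm{dist}_B(x,y)\leq t^{d+3t}$.
   Context: Graphs are finite and simple; $\mathrm{dist}_G(x,y)$ is the length (number of edges) of a shortest path between $x$ and $y$ in $G$. A territory is a pair $(T,B)$ where $T$ is a graph and $B$ is an induced cycle in $T$. Expansion (with respect to the fixed integer $t\geq 5$). Given a territory $(T',B')$, an expansion of it is any territory $(T,B)$ obtained as follows. Choose, for some integer $k\geq 0$, a stable set $\{x_1,\dots,x_k\}$ of vertices of $B'$, and for each $i$ let $x_i^-,x_i^+$ be the two neighbours of $x_i$ in $B'$. Choose $I\subseteq\{1,\dots,k\}$. Build $T$ from $T'$: for each $i$ add a new path $P_i$ of length $2t-6$ with ends $y_i^-,y_i^+$ and middle vertex $y_i$, and add edges $x_i^-y_i^-$, $x_iy_i$, $x_i^+y_i^+$; for each $i\in I$, with $v_i^-,v_i^+$ the neighbours of $y_i$ in $P_i$ ($v_i^-$ on the side of $y_i^-$), add a new path $Q_i$ of length $t-4$ with ends $z_i^-,z_i^+$ and edges $v_i^-z_i^-$, $v_i^+z_i^+$ (all added vertices new and distinct). For $i\notin I$ let $R_i=x_i^-\text{ - }y_i^-\text{ - }P_i\text{ - }y_i^+\text{ - }x_i^+$; for $i\in I$ let $R_i$ go $x_i^-,y_i^-$, along $P_i$ to $v_i^-$, then $z_i^-$, along $Q_i$ to $z_i^+$, then $v_i^+$, along $P_i$ to $y_i^+$,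 then $x_i^+$. Let $B=(B'\setminus\{x_1,\dots,x_k\})\cup R_1\cup\dots\cup R_k$. The territories $(T_m,B_m)$, $m\ge0$: $T_0$ is a $t$-cycle and $B_0=T_0$. For $m\geq1$, with $N=t(t-3)^{m-1}$ and $B_{m-1}=x_1\text{ - }\cdots\text{ - }x_N\text{ - }x_1$, obtain $T_m$ from $T_{m-1}$ by adding a new cycle $B_m$ which is the $(t-4)$-subdivision of an $N$-cycle $x_1'\text{ - }\cdots\text{ - }x_N'\text{ - }x_1'$ (each edge replaced by a path of length $t-3$) and adding the edges $x_ix_i'$, $i=1,\dots,N$. A territory $(T,B)$ is canonical if for some $m\geq 0$ there is an expansion $(T',B')$ of $(T_m,B_m)$ and an isomorphism $f:V(T)\to V(T')$ between $T$ and $T'$ whose restriction to $V(B)$ is an isomorphism between $B$ and $B'$. -}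

module Defs where

open import Level using (0ℓ)
open import Data.Nat using (ℕ; zero; suc; _+_; _*_; _∸_; _^_; _≤_)
open import Data.Fin using (Fin; toℕ)
open import Data.Bool using (Bool; true; false)
open import Data.Product using (Σ; _×_; _,_)
open import Data.Sum using (_⊎_; inj₁; inj₂)
open import Data.Empty using (⊥)
open import Data.Unit using (⊤)
open import Data.List using (List)
open import Data.List.Membership.Propositional using (_∈_)
open import Relation.Nullary using (¬_)
open import Relation.Binary.PropositionalEquality using (_≡_)
open import Function.Bundles using (_⇔_)

record Graph : Set₁ where
  field
    V        : Set
    _~_      : V → V → Set
    ~-sym    : ∀ {u v} → u ~ v → v ~ u
    ~-irrefl : ∀ {v} → ¬ (v ~ v)
    vertices : List V                -- finiteness: every vertex is listed
    complete : ∀ v → v ∈ vertices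

-- A graph given by a (directed) edge relation; adjacency is its symmetric
-- closure.  Used for the explicitly constructed graphs T_m and expansions.
record RawGraph : Set₁ where
  field
    V : Set
    E : V → V → Set

RAdj : (R : RawGraph) → RawGraph.V R → RawGraph.V R → Set
RAdj R u v = RawGraph.E R u v ⊎ RawGraph.E R v u

record Iso (G : Graph) (R : RawGraph) : Set where
  open Graph G
  field
    f       : V → RawGraph.V R
    g       : RawGraph.V R → V
    g∘f     : ∀ v → g (f v) ≡ v
    f∘g     : ∀ w → f (g w) ≡ w
    adj-iff : ∀ u v → (u ~ v) ⇔ RAdj R (f u) (f v)

-- Walk G S x y n : a walk of length n (number of edges) from x to y in G all
-- of whose vertices satisfy S, i.e. a walk in the induced subgraph G[S].
data Walk (G : Graph) (S : Graph.V G → Set) : Graph.V G → Graph.V G → ℕ → Set where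
  here : ∀ {x} → S x → Walk G S x x 0
  step : ∀ {x y z n} → S x → Graph._~_ G x y → Walk G S y z n → Walk G S x z (suc n)

-- dist_{G[S]}(x,y) ≤ d
DistLe : (G : Graph) → (Graph.V G → Set) → Graph.V G → Graph.V G → ℕ → Set
DistLe G S x y d = Σ ℕ λ n → n ≤ d × Walk G S x y n

Everything : {A : Set} → A → Set
Everything _ = ⊤

CycSucc : ℕ → ℕ → ℕ → Set
CycSucc L a b = (suc a ≡ b) ⊎ (suc a ≡ L × b ≡ 0)

CycAdj : (L : ℕ) → Fin L → Fin L → Set
CycAdj L i j = CycSucc L (toℕ i) (toℕ j) ⊎ CycSucc L (toℕ j) (toℕ i)

-- A territory (T,B): B an induced cycle of T, given by a cyclic enumeration
-- cyc : Fin len → V(T) of its vertices (len ≥ 3, injective, and two vertices of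
-- B are adjacent in T iff they are consecutive on the cycle).
record Territory : Set₁ where
  field
    T        : Graph
    len      : ℕ
    len≥3    : 3 ≤ len
    cyc      : Fin len → Graph.V T
    cyc-inj  : ∀ i j → cyc i ≡ cyc j → i ≡ j
    cyc-adj  : ∀ i j → Graph._~_ T (cyc i) (cyc j) ⇔ CycAdj len i j

  InB : Graph.V T → Set
  InB v = Σ (Fin len) λ i → v ≡ cyc i

module Construction (t : ℕ) where

  -- |V(B_m)| = t (t-3)^m
  Len : ℕ → ℕ
  Len m = t * (t ∸ 3) ^ m

  -- Vertices of T_m: T_0 is the cycle on Fin (Len 0); T_{m+1} adds the
  -- vertices of B_{m+1}, enumerated cyclically by Fin (Len (m+1)).
  VT : ℕ → Set
  VT zero    = Fin (Len zero)
  VT (suc m) = VT m ⊎ Fin (Len (suc m))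

  top : (m : ℕ) → Fin (Len m) → VT m
  top zero    p = p
  top (suc m) p = inj₂ p

  -- edges of T_m.  The vertex x_i' of B_{m+1} is position i·(t-3), and the
  -- positions strictly between consecutive x_i' are the subdivision vertices.
  ET : (m : ℕ) → VT m → VT m → Set
  ET zero    p q                 = CycSucc (Len zero) (toℕ p) (toℕ q)
  ET (suc m) (inj₁ u) (inj₁ v)   = ET m u v
  ET (suc m) (inj₂ p) (inj₂ q)   = CycSucc (Len (suc m)) (toℕ p) (toℕ q)
  ET (suc m) (inj₁ u) (inj₂ q)   =
    Σ (Fin (Len m)) λ p → u ≡ top m p × toℕ q ≡ toℕ p * (t ∸ 3)
  ET (suc m) (inj₂ _) (inj₁ _)   = ⊥

  Tm : ℕ → RawGraph
  Tm m = record { V = VT m ; E = ET m }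

  -- Expansion of a territory (G, B') where B' is enumerated cyclically by
  -- c : Fin L → V(G).

  record ExpData (G : RawGraph) (L : ℕ) (c : Fin L → RawGraph.V G) : Set where
    field
      k      : ℕ
      pos    : Fin k → Fin L                       -- x_i = c (pos i)
      pos-inj : ∀ i j → pos i ≡ pos j → i ≡ j
      stable : ∀ i j → ¬ RAdj G (c (pos i)) (c (pos j))
      I      : Fin k → Bool

  module _ (G : RawGraph) (L : ℕ) (c : Fin L → RawGraph.V G)
           (D : ExpData G L c) where
    open ExpData D
    open RawGraph G renaming (V to V'; E to E')

    -- P_i : vertices 0 .. 2t-6 (y_i^- = 0, y_i = t-3, y_i^+ = 2t-6,
    --        v_i^- = t-4, v_i^+ = t-2)
    -- Q_i (only for i ∈ I) : vertices 0 .. t-4 (z_i^- = 0, z_i^+ = t-4)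
    NewV : Set
    NewV = Σ (Fin k) λ i → Fin (2 * t ∸ 5) ⊎ ((I i ≡ true) × Fin (t ∸ 3))

    XV : Set
    XV = V' ⊎ NewV

    XE : XV → XV → Set
    XE (inj₁ u) (inj₁ v) = E' u v
    XE (inj₁ u) (inj₂ (i , inj₁ a)) =
        (toℕ a ≡ 0 × Σ (Fin L) λ q → u ≡ c q × CycSucc L (toℕ q) (toℕ (pos i)))   -- x_i^- y_i^-
      ⊎ (toℕ a ≡ t ∸ 3 × u ≡ c (pos i))                                            -- x_i y_i
      ⊎ (toℕ a ≡ 2 * t ∸ 6 × Σ (Fin L) λ q → u ≡ c q × CycSucc L (toℕ (pos i)) (toℕ q)) -- x_i^+ y_i^+
    XE (inj₁ _) (inj₂ (_ , inj₂ _)) = ⊥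
    XE (inj₂ (i , inj₁ a)) (inj₂ (j , inj₁ b)) = i ≡ j × suc (toℕ a) ≡ toℕ b
    XE (inj₂ (i , inj₁ a)) (inj₂ (j , inj₂ (_ , b))) =
      i ≡ j × ((toℕ a ≡ t ∸ 4 × toℕ b ≡ 0) ⊎ (toℕ a ≡ t ∸ 2 × toℕ b ≡ t ∸ 4))
    XE (inj₂ (i , inj₂ (_ , a))) (inj₂ (j , inj₂ (_ , b))) = i ≡ j × suc (toℕ a) ≡ toℕ b
    XE (inj₂ (_ , inj₂ _)) (inj₂ (_ , inj₁ _)) = ⊥
    XE (inj₂ _) (inj₁ _) = ⊥

    Expansion : RawGraph
    Expansion = record { V = XV ; E = XE }

    -- V(B) = (V(B') \ {x_1..x_k}) ∪ V(R_1) ∪ ... ∪ V(R_k)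
    InXB : XV → Set
    InXB (inj₁ u) = (Σ (Fin L) λ q → u ≡ c q) × (∀ i → ¬ (u ≡ c (pos i)))
    InXB (inj₂ (i , inj₁ a)) = I i ≡ true → ¬ (toℕ a ≡ t ∸ 3)
    InXB (inj₂ (_ , inj₂ _)) = ⊤

  Canonical : Territory → Set
  Canonical Θ =
    Σ ℕ λ m → Σ (ExpData (Tm m) (Len m) (top m)) λ D →
    Σ (Iso (Territory.T Θ) (Expansion (Tm m) (Len m) (top m) D)) λ φ →
      ∀ v → Territory.InB Θ v ⇔ InXB (Tm m) (Len m) (top m) D (Iso.f φ v)

{-# OPTIONS --safe #-}
module Submission where

open import Defs
open import Data.Nat using (ℕ; zero; suc; _+_; _*_; _^_; _∸_; _⊔_; _≤_; _<_; _<?_; _≤?_; z≤n; s≤s; s≤s⁻¹; NonZero; >-nonZero)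
open import Data.Nat.Properties
import Data.Nat.Divisibility as ℕ∣
import Data.Nat.Tactic.RingSolver as ℕ-Solver
open import Data.Integer as ℤ using (ℤ; +_; -[1+_]; 0ℤ; 1ℤ; -1ℤ; ∣_∣)
import Data.Integer.Properties as ℤₚ
open import Data.Integer.Divisibility.Signed using (_∣_; divides; ∣⇒∣ᵤ; ∣m⇒∣-m; ∣m∣n⇒∣m+n; *-monoˡ-∣; module ∣-Reasoning)
import Data.Integer.Tactic.RingSolver as ℤ-Solver
open import Data.Fin as Fin using (Fin; toℕ; fromℕ; fromℕ<)
import Data.Fin.Properties as Finₚ
open import Data.Bool using (true; false)
open import Data.Product using (Σ; ∃; _×_; _,_; proj₂)
open import Data.Sum using (inj₁; inj₂)
open import Data.Unit using (tt)
open import Relation.Nullary using (¬_; Dec; yes; no; contradiction)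
open import Relation.Binary.PropositionalEquality
open import Function.Base using (_$_; case_of_)
open import Function.Bundles using (_⇔_; Equivalence)

-- Give every vertex of T_m a depth (it lies on B_{m-d}) and a shadow on B_m (its
-- position times (t-3)^d).  An edge either changes the depth by one and keeps the
-- shadow, or stays at depth d and moves the shadow by at most (t-3)^d around B_m.
-- Walking backwards from the end of a walk, where the depth is 0, the budget at
-- most doubles per step, so a walk of length n between vertices of B moves the
-- shadow by at most (t-3)^n ≤ t^d; the vertices of the new paths R_i, Q_i inherit
-- the shadow of x_i.  Along B, every position of B_m has an anchor (x_p itself, or
-- y_i⁻ when x_p = x_i), consecutive anchors are at most 4t apart and every vertex of
-- B is within 3t of its anchor, so dist_B(x,y) ≤ 3t + t^d · 4t + 3t ≤ t^(d+3t).

m+k≡n⇒m≤n : ∀ {m n} k → m + k ≡ n → m ≤ n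
m+k≡n⇒m≤n {m} k refl = m≤m+n m k

RAdj-sym : ∀ (R : RawGraph) {u v} → RAdj R u v → RAdj R v u
RAdj-sym R (inj₁ e) = inj₂ e
RAdj-sym R (inj₂ e) = inj₁ e

module RawWalks (R : RawGraph) (P : RawGraph.V R → Set) where
  open RawGraph R

  data RawWalk : V → V → ℕ → Set where
    here : ∀ {x} → P x → RawWalk x x 0
    step : ∀ {x y z n} → P x → RAdj R x y → RawWalk y z n → RawWalk x z (suc n)

  walk-snoc : ∀ {x y z n} → RawWalk x y n → RAdj R y z → P z → RawWalk x z (suc n)
  walk-snoc (here p)     e′ p′ = step p e′ (here p′)
  walk-snoc (step p e w) e′ p′ = step p e (walk-snoc w e′ p′)

  walk-reverse : ∀ {x y n} → RawWalk x y n → RawWalk y x n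
  walk-reverse (here p)     = here p
  walk-reverse (step p e w) = walk-snoc (walk-reverse w) (RAdj-sym R e) p

  walk-++ : ∀ {x y z m n} → RawWalk x y m → RawWalk y z n → RawWalk x z (m + n)
  walk-++ (here _)     w′ = w′
  walk-++ (step p e w) w′ = step p e (walk-++ w w′)

  RawWalk≤ : V → V → ℕ → Set
  RawWalk≤ x y n = Σ ℕ λ l → l ≤ n × RawWalk x y l

  walk≤-++ : ∀ {x y z m n} → RawWalk≤ x y m → RawWalk≤ y z n → RawWalk≤ x z (m + n)
  walk≤-++ (l , l≤m , w) (l′ , l′≤n , w′) = l + l′ , +-mono-≤ l≤m l′≤n , walk-++ w w′

  walk≤-reverse : ∀ {x y n} → RawWalk≤ x y n → RawWalk≤ y x n
  walk≤-reverse (l , l≤n , w) = l , l≤n , walk-reverse w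

  walk≤-weaken : ∀ {x y m n} → m ≤ n → RawWalk≤ x y m → RawWalk≤ x y n
  walk≤-weaken m≤n (l , l≤m , w) = l , ≤-trans l≤m m≤n , w

  walk-along-path : ∀ {N} (v : Fin N → V) →
    (∀ {a b} → suc (toℕ a) ≡ toℕ b → E (v a) (v b)) →
    ∀ δ {a b} → toℕ a + δ ≡ toℕ b →
    (∀ c → toℕ a ≤ toℕ c → toℕ c ≤ toℕ b → P (v c)) → RawWalk (v a) (v b) δ
  walk-along-path v edge zero {a} a+0≡b inside =
    subst (λ b → RawWalk (v a) (v b) 0) a≡b (here (inside a ≤-refl (≤-reflexive (cong toℕ a≡b))))
    where
    a≡b = Finₚ.toℕ-injective (trans (sym (+-identityʳ (toℕ a))) a+0≡b)
  walk-along-path v edge (suc δ) {a} {b} a+1+δ≡b inside =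
    step (inside a ≤-refl (≤-trans (n≤1+n (toℕ a)) a+1≤b)) (inj₁ (edge (sym toℕ-a′)))
         (walk-along-path v edge δ a′+δ≡b λ c a′≤c →
            inside c (≤-trans (n≤1+n (toℕ a)) (subst (_≤ toℕ c) toℕ-a′ a′≤c)))
    where
    a+1+δ≡b′ : suc (toℕ a) + δ ≡ toℕ b
    a+1+δ≡b′ = trans (sym (+-suc (toℕ a) δ)) a+1+δ≡b
    a+1≤b : suc (toℕ a) ≤ toℕ b
    a+1≤b = subst (suc (toℕ a) ≤_) a+1+δ≡b′ (m≤m+n (suc (toℕ a)) δ)
    a′ = fromℕ< (≤-<-trans a+1≤b (Finₚ.toℕ<n b))
    toℕ-a′ : toℕ a′ ≡ suc (toℕ a)
    toℕ-a′ = Finₚ.toℕ-fromℕ< _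
    a′+δ≡b : toℕ a′ + δ ≡ toℕ b
    a′+δ≡b = trans (cong (_+ δ) toℕ-a′) a+1+δ≡b′

module _ {G : Graph} {R : RawGraph} (φ : Iso G R) where
  open Iso φ
  open RawWalks

  walk⇒raw : ∀ {S S′} → (∀ v → S v → S′ (f v)) →
    ∀ {x y n} → Walk G S x y n → RawWalk R S′ (f x) (f y) n
  walk⇒raw S⇒S′ (here {x} s)       = here (S⇒S′ x s)
  walk⇒raw S⇒S′ (step {x} {y} s e w) =
    step (S⇒S′ x s) (Equivalence.to (adj-iff x y) e) (walk⇒raw S⇒S′ w)

  raw⇒walk : ∀ {S S′} → (∀ w → S′ w → S (g w)) →
    ∀ {a b n} → RawWalk R S′ a b n → Walk G S (g a) (g b) n
  raw⇒walk S′⇒S (here {a} s)       = here (S′⇒S a s)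
  raw⇒walk S′⇒S (step {a} {b} s e w) =
    step (S′⇒S a s) (Equivalence.from (adj-iff (g a) (g b)) (subst₂ (RAdj R) (sym (f∘g a)) (sym (f∘g b)) e))
         (raw⇒walk S′⇒S w)

infix 4 _≡_mod_
data _≡_mod_ (x y : ℤ) (L : ℕ) : Set where
  ≡mod : + L ∣ y ℤ.- x → x ≡ y mod L

≡⇒≡mod : ∀ {L x y} → x ≡ y → x ≡ y mod L
≡⇒≡mod {L} {x} refl = ≡mod $ divides 0ℤ (trans (ℤₚ.+-inverseʳ x) (sym (ℤₚ.*-zeroˡ (+ L))))

≡mod-sym : ∀ {L x y} → x ≡ y mod L → y ≡ x mod L
≡mod-sym {L} {x} {y} (≡mod L∣y-x) = ≡mod $ begin
    + L             ∣⟨ ∣m⇒∣-m L∣y-x ⟩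
    ℤ.- (y ℤ.- x)   ≡⟨ negate-difference y x ⟩
    x ℤ.- y         ∎
  where
  open ∣-Reasoning
  negate-difference : ∀ y x → ℤ.- (y ℤ.- x) ≡ x ℤ.- y
  negate-difference = ℤ-Solver.solve-∀

≡mod-trans : ∀ {L x y z} → x ≡ y mod L → y ≡ z mod L → x ≡ z mod L
≡mod-trans {L} {x} {y} {z} (≡mod L∣y-x) (≡mod L∣z-y) = ≡mod $ begin
    + L                       ∣⟨ ∣m∣n⇒∣m+n L∣z-y L∣y-x ⟩
    (z ℤ.- y) ℤ.+ (y ℤ.- x)   ≡⟨ telescope z y x ⟩
    z ℤ.- x                   ∎
  where
  open ∣-Reasoning
  telescope : ∀ z y x → (z ℤ.- y) ℤ.+ (y ℤ.- x) ≡ z ℤ.- x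
  telescope = ℤ-Solver.solve-∀

≡mod-+ʳ : ∀ {L x y} s → x ≡ y mod L → x ℤ.+ s ≡ y ℤ.+ s mod L
≡mod-+ʳ {L} {x} {y} s (≡mod L∣y-x) = ≡mod $ begin
    + L                           ∣⟨ L∣y-x ⟩
    y ℤ.- x                       ≡⟨ cancel-shift y x s ⟩
    (y ℤ.+ s) ℤ.- (x ℤ.+ s)       ∎
  where
  open ∣-Reasoning
  cancel-shift : ∀ y x s → y ℤ.- x ≡ (y ℤ.+ s) ℤ.- (x ℤ.+ s)
  cancel-shift = ℤ-Solver.solve-∀

≡mod-*ʳ : ∀ {L x y} c → x ≡ y mod L → x ℤ.* + c ≡ y ℤ.* + c mod (L * c)
≡mod-*ʳ {L} {x} {y} c (≡mod L∣y-x) =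
  ≡mod $ subst (λ k → k ∣ y ℤ.* + c ℤ.- x ℤ.* + c) (sym (ℤₚ.pos-* L c)) (begin
    + L ℤ.* + c               ∣⟨ *-monoˡ-∣ (+ c) L∣y-x ⟩
    (y ℤ.- x) ℤ.* + c         ≡⟨ distrib y x (+ c) ⟩
    y ℤ.* + c ℤ.- x ℤ.* + c   ∎)
  where
  open ∣-Reasoning
  distrib : ∀ y x c → (y ℤ.- x) ℤ.* c ≡ y ℤ.* c ℤ.- x ℤ.* c
  distrib = ℤ-Solver.solve-∀

≡mod⇒≡ : ∀ {L a b} → a < L → b < L → + a ≡ + b mod L → a ≡ b
≡mod⇒≡ {L} {a} {b} a<L b<L (≡mod L∣b-a) with ∣ + b ℤ.- + a ∣ in eq
... | zero  = sym (ℤₚ.+-injective (ℤₚ.i-j≡0⇒i≡j (+ b) (+ a) (ℤₚ.∣i∣≡0⇒i≡0 eq)))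
... | suc k = contradiction (subst (L ℕ∣.∣_) eq (∣⇒∣ᵤ L∣b-a))
                            (ℕ∣.>⇒∤ (≤-<-trans (subst (_≤ b ⊔ a) eq |b-a|≤b⊔a) (⊔-pres-<m b<L a<L)))
  where
  |b-a|≤b⊔a : ∣ + b ℤ.- + a ∣ ≤ b ⊔ a
  |b-a|≤b⊔a = subst (λ i → ∣ i ∣ ≤ b ⊔ a) (sym (ℤₚ.m-n≡m⊖n b a)) (ℤₚ.∣m⊝n∣≤m⊔n b a)

Near : ℕ → ℕ → ℕ → ℕ → Set
Near L D a b = Σ ℤ λ s → ∣ s ∣ ≤ D × + a ℤ.+ s ≡ + b mod L

near-refl : ∀ {L D a} → Near L D a a
near-refl {a = a} = 0ℤ , z≤n , ≡⇒≡mod (ℤₚ.+-identityʳ (+ a))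

≡mod-move : ∀ {L x y} s → x ℤ.+ s ≡ y mod L → y ℤ.- s ≡ x mod L
≡mod-move {x = x} s x+s≡y = ≡mod-trans (≡mod-+ʳ (ℤ.- s) (≡mod-sym x+s≡y)) (≡⇒≡mod (unshift x s))
  where
  unshift : ∀ x s → x ℤ.+ s ℤ.- s ≡ x
  unshift = ℤ-Solver.solve-∀

near-sym : ∀ {L D a b} → Near L D a b → Near L D b a
near-sym (s , ∣s∣≤D , a+s≡b) =
  ℤ.- s , subst (_≤ _) (sym (ℤₚ.∣-i∣≡∣i∣ s)) ∣s∣≤D , ≡mod-move s a+s≡b

near-trans : ∀ {L D D′ a b c} → Near L D a b → Near L D′ b c → Near L (D + D′) a c
near-trans {a = a} (s , ∣s∣≤D , a+s≡b) (s′ , ∣s′∣≤D′ , b+s′≡c) =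
  s ℤ.+ s′ , ≤-trans (ℤₚ.∣i+j∣≤∣i∣+∣j∣ s s′) (+-mono-≤ ∣s∣≤D ∣s′∣≤D′) ,
  ≡mod-trans (≡⇒≡mod (sym (ℤₚ.+-assoc (+ a) s s′))) (≡mod-trans (≡mod-+ʳ s′ a+s≡b) b+s′≡c)

near-weaken : ∀ {L D D′ a b} → D ≤ D′ → Near L D a b → Near L D′ a b
near-weaken D≤D′ (s , ∣s∣≤D , a+s≡b) = s , ≤-trans ∣s∣≤D D≤D′ , a+s≡b

near-*ʳ : ∀ {L D a b} c → Near L D a b → Near (L * c) (c * D) (a * c) (b * c)
near-*ʳ {D = D} {a} {b} c (s , ∣s∣≤D , a+s≡b) =
  s ℤ.* + c ,
  subst (_≤ c * D) (sym (ℤₚ.abs-* s (+ c))) (subst (_≤ c * D) (*-comm c ∣ s ∣) (*-monoʳ-≤ c ∣s∣≤D)) ,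
  subst₂ (λ x y → x ≡ y mod _) (distrib a) (sym (ℤₚ.pos-* b c)) (≡mod-*ʳ c a+s≡b)
  where
  distrib : ∀ a → (+ a ℤ.+ s) ℤ.* + c ≡ + (a * c) ℤ.+ s ℤ.* + c
  distrib a = trans (ℤₚ.*-distribʳ-+ (+ c) (+ a) s) (cong (ℤ._+ s ℤ.* + c) (sym (ℤₚ.pos-* a c)))

CycSucc⇒≡mod : ∀ {L a b} → CycSucc L a b → + a ℤ.+ 1ℤ ≡ + b mod L
CycSucc⇒≡mod {a = a} c = ≡mod-trans (≡⇒≡mod a+1≡suc-a) (suc-a≡b c)
  where
  a+1≡suc-a : + a ℤ.+ 1ℤ ≡ + suc a
  a+1≡suc-a = trans (sym (ℤₚ.pos-+ a 1)) (cong +_ (+-comm a 1))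
  negate : ∀ x → 0ℤ ℤ.- x ≡ -1ℤ ℤ.* x
  negate = ℤ-Solver.solve-∀
  suc-a≡b : ∀ {L b} → CycSucc L a b → + suc a ≡ + b mod L
  suc-a≡b (inj₁ refl)          = ≡⇒≡mod refl
  suc-a≡b (inj₂ (refl , refl)) = ≡mod (divides -1ℤ (negate (+ suc a)))

CycSucc⇒near : ∀ {L a b} → CycSucc L a b → Near L 1 a b
CycSucc⇒near c = 1ℤ , ≤-refl , CycSucc⇒≡mod c

CycSucc-next : ∀ {L} (p : Fin L) → Σ (Fin L) λ q → CycSucc L (toℕ p) (toℕ q)
CycSucc-next {suc L} p with suc (toℕ p) <? suc L
... | yes p+1<L = fromℕ< p+1<L , inj₁ (sym (Finₚ.toℕ-fromℕ< p+1<L))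
... | no  p+1≮L = Fin.zero , inj₂ (≤-antisym (Finₚ.toℕ<n p) (≮⇒≥ p+1≮L) , refl)

data LayerStep (r L : ℕ) : ℕ → ℕ → ℕ → ℕ → Set where
  along     : ∀ {d a b} → Near L (r ^ d) a b → LayerStep r L d d a b
  deeper    : ∀ {d a} → LayerStep r L d (suc d) a a
  shallower : ∀ {d a} → LayerStep r L (suc d) d a a

LayerStep-sym : ∀ {r L d d′ a b} → LayerStep r L d d′ a b → LayerStep r L d′ d b a
LayerStep-sym (along n) = along (near-sym n)
LayerStep-sym deeper    = shallower
LayerStep-sym shallower = deeper

LayerStep-*ʳ : ∀ {r L d d′ a b} → LayerStep r L d d′ a b →
  LayerStep r (L * r) (suc d) (suc d′) (a * r) (b * r)
LayerStep-*ʳ {r} (along n) = along (near-*ʳ r n)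
LayerStep-*ʳ deeper        = deeper
LayerStep-*ʳ shallower     = shallower

LayerStep⇒near : ∀ {r L d d′ a b} → LayerStep r L d d′ a b → d ≤ suc d′ × Near L (r ^ d′) a b
LayerStep⇒near {d = d} (along n) = n≤1+n d , n
LayerStep⇒near {d = d} deeper    = ≤-trans (n≤1+n d) (n≤1+n (suc d)) , near-refl
LayerStep⇒near shallower         = ≤-refl , near-refl

module _ {R : RawGraph} {r L : ℕ} (2≤r : 2 ≤ r) (depth shadow : RawGraph.V R → ℕ)
         (edge : ∀ {u v} → RAdj R u v → LayerStep r L (depth u) (depth v) (shadow u) (shadow v)) where
  open RawWalks R

  -- Inducting from the far end, the step and the rest both fit in r ^ (depth v + n),
  -- and two such budgets fit in the next one since r ≥ 2.
  walk⇒near : ∀ {P u v n} → RawWalk P u v n →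
    depth u ≤ depth v + n × Near L (r ^ (depth v + n)) (shadow u) (shadow v)
  walk⇒near {v = v} (here _) = ≤-reflexive (sym (+-identityʳ (depth v))) , near-refl
  walk⇒near {u = u} {v} (step {y = w} {n = n} _ e rest)
    with LayerStep⇒near (edge e) | walk⇒near rest
  ... | u≤w+1 , u~w | w≤v+n , w~v =
    ≤-trans u≤w+1 (≤-trans (s≤s w≤v+n) (≤-reflexive (sym (+-suc (depth v) n)))) ,
    near-weaken budgets (near-trans (near-weaken (^-monoʳ-≤ r {{r≢0}} w≤v+n) u~w) w~v)
    where
    r≢0 : NonZero r
    r≢0 = >-nonZero (≤-trans (s≤s z≤n) 2≤r)
    x = r ^ (depth v + n)
    budgets : x + x ≤ r ^ (depth v + suc n)
    budgets = begin
      x + x        ≡⟨ cong (_+_ x) (sym (+-identityʳ x)) ⟩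
      2 * x        ≤⟨ *-monoˡ-≤ x 2≤r ⟩
      r * x        ≡⟨ cong (r ^_) (sym (+-suc (depth v) n)) ⟩
      r ^ (depth v + suc n) ∎
      where open ≤-Reasoning

module Layers (t : ℕ) where
  open Construction t

  depth : ∀ m → VT m → ℕ
  depth zero    _        = 0
  depth (suc m) (inj₁ v) = suc (depth m v)
  depth (suc m) (inj₂ _) = 0

  shadow : ∀ m → VT m → ℕ
  shadow zero    p        = toℕ p
  shadow (suc m) (inj₁ v) = shadow m v * (t ∸ 3)
  shadow (suc m) (inj₂ p) = toℕ p

  depth-top : ∀ m p → depth m (top m p) ≡ 0
  depth-top zero    p = refl
  depth-top (suc m) p = refl

  shadow-top : ∀ m p → shadow m (top m p) ≡ toℕ p
  shadow-top zero    p = refl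
  shadow-top (suc m) p = refl

  top-injective : ∀ m {p q} → top m p ≡ top m q → p ≡ q
  top-injective zero    p≡q  = p≡q
  top-injective (suc m) refl = refl

  CycSucc⇒ET : ∀ m {p q} → CycSucc (Len m) (toℕ p) (toℕ q) → ET m (top m p) (top m q)
  CycSucc⇒ET zero    c = c
  CycSucc⇒ET (suc m) c = c

  Len-suc : ∀ m → Len m * (t ∸ 3) ≡ Len (suc m)
  Len-suc m = trans (*-assoc t ((t ∸ 3) ^ m) (t ∸ 3)) (cong (t *_) (*-comm ((t ∸ 3) ^ m) (t ∸ 3)))

  ET⇒LayerStep : ∀ m {v w} → ET m v w →
    LayerStep (t ∸ 3) (Len m) (depth m v) (depth m w) (shadow m v) (shadow m w)
  ET⇒LayerStep zero c = along (CycSucc⇒near c)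
  ET⇒LayerStep (suc m) {inj₁ v} {inj₁ w} e =
    subst (λ L → LayerStep (t ∸ 3) L (suc (depth m v)) (suc (depth m w)) (shadow m v * (t ∸ 3)) (shadow m w * (t ∸ 3)))
          (Len-suc m) (LayerStep-*ʳ (ET⇒LayerStep m e))
  ET⇒LayerStep (suc m) {inj₂ p} {inj₂ q} c = along (CycSucc⇒near c)
  ET⇒LayerStep (suc m) {inj₁ _} {inj₂ q} (p , refl , q≡p*r)
    rewrite depth-top m p | shadow-top m p | q≡p*r = shallower

module Bounds (u : ℕ) where
  t : ℕ
  t = 5 + u

  open Construction t
  open Layers t

  module Expansion-of (m : ℕ) (D : ExpData (Tm m) (Len m) (top m)) where
    open ExpData D

    L : ℕ
    L = Len m

    X : RawGraph
    X = Expansion (Tm m) L (top m) D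

    V′ : Set
    V′ = XV (Tm m) L (top m) D

    InB′ : V′ → Set
    InB′ = InXB (Tm m) L (top m) D

    depthˣ : V′ → ℕ
    depthˣ (inj₁ v) = depth m v
    depthˣ (inj₂ _) = 0

    shadowˣ : V′ → ℕ
    shadowˣ (inj₁ v)       = shadow m v
    shadowˣ (inj₂ (i , _)) = toℕ (pos i)

    XE⇒LayerStep : ∀ {v w} → XE (Tm m) L (top m) D v w →
      LayerStep (t ∸ 3) L (depthˣ v) (depthˣ w) (shadowˣ v) (shadowˣ w)
    XE⇒LayerStep {inj₁ _} {inj₁ _} e = ET⇒LayerStep m e
    XE⇒LayerStep {inj₁ _} {inj₂ (i , inj₁ _)} (inj₁ (_ , q , refl , q→xᵢ))
      rewrite depth-top m q | shadow-top m q = along (CycSucc⇒near q→xᵢ)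
    XE⇒LayerStep {inj₁ _} {inj₂ (i , inj₁ _)} (inj₂ (inj₁ (_ , refl)))
      rewrite depth-top m (pos i) | shadow-top m (pos i) = along near-refl
    XE⇒LayerStep {inj₁ _} {inj₂ (i , inj₁ _)} (inj₂ (inj₂ (_ , q , refl , xᵢ→q)))
      rewrite depth-top m q | shadow-top m q = along (near-sym (CycSucc⇒near xᵢ→q))
    XE⇒LayerStep {inj₂ (_ , inj₁ _)} {inj₂ (_ , inj₁ _)} (refl , _) = along near-refl
    XE⇒LayerStep {inj₂ (_ , inj₁ _)} {inj₂ (_ , inj₂ _)} (refl , _) = along near-refl
    XE⇒LayerStep {inj₂ (_ , inj₂ _)} {inj₂ (_ , inj₂ _)} (refl , _) = along near-refl

    RAdj⇒LayerStep : ∀ {v w} → RAdj X v w →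
      LayerStep (t ∸ 3) L (depthˣ v) (depthˣ w) (shadowˣ v) (shadowˣ w)
    RAdj⇒LayerStep {v} {w} (inj₁ e) = XE⇒LayerStep {v} {w} e
    RAdj⇒LayerStep {v} {w} (inj₂ e) = LayerStep-sym (XE⇒LayerStep {w} {v} e)

    open RawWalks X InB′

    P : Fin k → Fin (2 * t ∸ 5) → V′
    P i a = inj₂ (i , inj₁ a)

    Q : (i : Fin k) → I i ≡ true → Fin (t ∸ 3) → V′
    Q i e b = inj₂ (i , inj₂ (e , b))

    2t∸5≡5+2u : 2 * t ∸ 5 ≡ 5 + 2 * u
    2t∸5≡5+2u = cong (_∸ 5) (*-distribˡ-+ 2 5 u)

    2t∸6≡4+2u : 2 * t ∸ 6 ≡ 4 + 2 * u
    2t∸6≡4+2u = cong (_∸ 6) (*-distribˡ-+ 2 5 u)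

    u≤c+2u : ∀ c → u ≤ c + 2 * u
    u≤c+2u c = ≤-trans (m≤m+n u (u + 0)) (m≤n+m (2 * u) c)

    P-index : ∀ j → j ≤ 4 + 2 * u → Fin (2 * t ∸ 5)
    P-index j j≤ = fromℕ< (subst (suc j ≤_) (sym 2t∸5≡5+2u) (s≤s j≤))

    y⁻ v⁻ v⁺ y⁺ : Fin (2 * t ∸ 5)
    y⁻ = P-index 0 z≤n
    v⁻ = P-index (1 + u) (s≤s (u≤c+2u 3))
    v⁺ = P-index (3 + u) (s≤s (s≤s (s≤s (u≤c+2u 1))))
    y⁺ = P-index (4 + 2 * u) ≤-refl

    toℕ-y⁻ : toℕ y⁻ ≡ 0
    toℕ-y⁻ = Finₚ.toℕ-fromℕ< _
    toℕ-v⁻ : toℕ v⁻ ≡ 1 + u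
    toℕ-v⁻ = Finₚ.toℕ-fromℕ< _
    toℕ-v⁺ : toℕ v⁺ ≡ 3 + u
    toℕ-v⁺ = Finₚ.toℕ-fromℕ< _
    toℕ-y⁺ : toℕ y⁺ ≡ 4 + 2 * u
    toℕ-y⁺ = Finₚ.toℕ-fromℕ< _

    z⁻ z⁺ : Fin (t ∸ 3)
    z⁻ = Fin.zero
    z⁺ = fromℕ (suc u)

    P-walk : ∀ i δ {a b} → toℕ a + δ ≡ toℕ b →
      (∀ c → toℕ a ≤ toℕ c → toℕ c ≤ toℕ b → InB′ (P i c)) → RawWalk (P i a) (P i b) δ
    P-walk i = walk-along-path (P i) (refl ,_)

    Q-walk : ∀ i e δ {a b} → toℕ a + δ ≡ toℕ b → RawWalk (Q i e a) (Q i e b) δ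
    Q-walk i e δ a+δ≡b = walk-along-path (Q i e) (refl ,_) δ a+δ≡b λ _ _ _ → tt

    y⁻∈B : ∀ i → InB′ (P i y⁻)
    y⁻∈B i _ y⁻≡y = 0≢1+n (trans (sym toℕ-y⁻) y⁻≡y)

    y⁺∈B : ∀ i → InB′ (P i y⁺)
    y⁺∈B i _ y⁺≡y = <⇒≢ (s≤s (s≤s (s≤s (u≤c+2u 1)))) (sym (trans (sym toℕ-y⁺) y⁺≡y))

    y⁻→z⁻ : ∀ i e → RawWalk (P i y⁻) (Q i e z⁻) (2 + u)
    y⁻→z⁻ i e = walk-snoc (P-walk i (1 + u) (trans (cong (_+ (1 + u)) toℕ-y⁻) (sym toℕ-v⁻)) below-y)
                          (inj₁ (refl , inj₁ (toℕ-v⁻ , refl))) tt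
      where
      below-y : ∀ c → toℕ y⁻ ≤ toℕ c → toℕ c ≤ toℕ v⁻ → InB′ (P i c)
      below-y c _ c≤v⁻ _ c≡y = 1+n≰n (subst (_≤ 1 + u) c≡y (subst (toℕ c ≤_) toℕ-v⁻ c≤v⁻))

    P-bound : ∀ (a : Fin (2 * t ∸ 5)) → toℕ a ≤ 4 + 2 * u
    P-bound a = s≤s⁻¹ (subst (toℕ a <_) 2t∸5≡5+2u (Finₚ.toℕ<n a))

    Q-bound : ∀ (b : Fin (t ∸ 3)) → toℕ b ≤ 1 + u
    Q-bound b = s≤s⁻¹ (Finₚ.toℕ<n b)

    climb-Q : ∀ i e b → RawWalk≤ (P i y⁻) (Q i e b) (3 * t)
    climb-Q i e b = _ , length-bound , walk-++ (y⁻→z⁻ i e) (Q-walk i e (toℕ b) refl)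
      where
      slack : ∀ u → (2 + u) + (1 + u) + (12 + u) ≡ 3 * (5 + u)
      slack = ℕ-Solver.solve-∀
      length-bound : 2 + u + toℕ b ≤ 3 * t
      length-bound = begin
        2 + u + toℕ b     ≤⟨ +-monoʳ-≤ (2 + u) (Q-bound b) ⟩
        2 + u + (1 + u)   ≤⟨ m+k≡n⇒m≤n (12 + u) (slack u) ⟩
        3 * t             ∎
        where open ≤-Reasoning

    climb-P-directly : ∀ i a → (∀ c → toℕ c ≤ toℕ a → InB′ (P i c)) →
      RawWalk≤ (P i y⁻) (P i a) (3 * t)
    climb-P-directly i a below-a =
      toℕ a , ≤-trans (P-bound a) (m+k≡n⇒m≤n (11 + u) (slack u)) ,
      P-walk i (toℕ a) (cong (_+ toℕ a) toℕ-y⁻) λ c _ → below-a c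
      where
      slack : ∀ u → (4 + 2 * u) + (11 + u) ≡ 3 * (5 + u)
      slack = ℕ-Solver.solve-∀

    -- With y_i deleted from B, the path P_i is left through Q_i.
    climb-P-around : ∀ i (e : I i ≡ true) a → 3 + u ≤ toℕ a → RawWalk≤ (P i y⁻) (P i a) (3 * t)
    climb-P-around i e a v⁺≤a =
      _ , length-bound ,
      walk-++ (walk-snoc (walk-++ (y⁻→z⁻ i e) (Q-walk i e (1 + u) (sym (Finₚ.toℕ-fromℕ (suc u)))))
                         (inj₂ (refl , inj₂ (toℕ-v⁺ , Finₚ.toℕ-fromℕ (suc u)))) v⁺∈B)
              (P-walk i (toℕ a ∸ (3 + u)) v⁺+δ≡a above-y)
      where
      v⁺+δ≡a : toℕ v⁺ + (toℕ a ∸ (3 + u)) ≡ toℕ a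
      v⁺+δ≡a = trans (cong (_+ (toℕ a ∸ (3 + u))) toℕ-v⁺) (m+[n∸m]≡n v⁺≤a)
      v⁺∈B : InB′ (P i v⁺)
      v⁺∈B _ v⁺≡y = 1+n≢n (trans (sym toℕ-v⁺) v⁺≡y)
      above-y : ∀ c → toℕ v⁺ ≤ toℕ c → toℕ c ≤ toℕ a → InB′ (P i c)
      above-y c v⁺≤c _ _ c≡y = 1+n≰n (subst (3 + u ≤_) c≡y (subst (_≤ toℕ c) toℕ-v⁺ v⁺≤c))
      slack : ∀ u → suc ((2 + u) + (1 + u)) + (1 + u) + 10 ≡ 3 * (5 + u)
      slack = ℕ-Solver.solve-∀
      length-bound : suc ((2 + u) + (1 + u)) + (toℕ a ∸ (3 + u)) ≤ 3 * t
      length-bound = begin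
        suc (2 + u + (1 + u)) + (toℕ a ∸ (3 + u))  ≤⟨ +-monoʳ-≤ (suc (2 + u + (1 + u))) a-v⁺≤1+u ⟩
        suc (2 + u + (1 + u)) + (1 + u)            ≤⟨ m+k≡n⇒m≤n 10 (slack u) ⟩
        3 * t                                      ∎
        where
        open ≤-Reasoning
        split : ∀ u → 4 + 2 * u ≡ 3 + u + (1 + u)
        split = ℕ-Solver.solve-∀
        a-v⁺≤1+u : toℕ a ∸ (3 + u) ≤ 1 + u
        a-v⁺≤1+u = m≤n+o⇒m∸n≤o (toℕ a) (3 + u) (≤-trans (P-bound a) (≤-reflexive (split u)))

    climb-P : ∀ i a → InB′ (P i a) → RawWalk≤ (P i y⁻) (P i a) (3 * t)
    climb-P i a a∈B with I i in eq | toℕ a ≤? 2 + u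
    ... | false | _       = climb-P-directly i a λ _ _ e _ → case trans (sym eq) e of λ ()
    ... | true  | yes a≤y = climb-P-directly i a λ c c≤a _ c≡y →
                              a∈B refl (≤-antisym a≤y (subst (_≤ toℕ a) c≡y c≤a))
    ... | true  | no  a≰y = climb-P-around i eq a (≰⇒> a≰y)

    is-x : (p : Fin L) → Dec (∃ λ i → pos i ≡ p)
    is-x p = Finₚ.any? λ i → pos i Fin.≟ p

    anchor : Fin L → V′
    anchor p with is-x p
    ... | yes (i , _) = P i y⁻
    ... | no _        = inj₁ (top m p)

    anchor-x : ∀ i → anchor (pos i) ≡ P i y⁻
    anchor-x i with is-x (pos i)
    ... | yes (j , xⱼ≡xᵢ) = cong (λ j → P j y⁻) (pos-inj j i xⱼ≡xᵢ)
    ... | no not-x        = contradiction (i , refl) not-x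

    anchor-old : ∀ p → ¬ (∃ λ i → pos i ≡ p) → anchor p ≡ inj₁ (top m p)
    anchor-old p not-x with is-x p
    ... | yes x = contradiction x not-x
    ... | no _  = refl

    old∈B : ∀ p → ¬ (∃ λ i → pos i ≡ p) → InB′ (inj₁ (top m p))
    old∈B p not-x = (p , refl) , λ i p≡xᵢ → not-x (i , sym (top-injective m p≡xᵢ))

    anchor∈B : ∀ p → InB′ (anchor p)
    anchor∈B p with is-x p
    ... | yes (i , _) = y⁻∈B i
    ... | no not-x    = old∈B p not-x

    anchor-step : ∀ {p q} → CycSucc L (toℕ p) (toℕ q) → RawWalk≤ (anchor p) (anchor q) (4 * t)
    anchor-step {p} {q} p→q with is-x p | is-x q
    ... | no p-old | no q-old =
      1 , s≤s z≤n , step (old∈B p p-old) (inj₁ (CycSucc⇒ET m p→q)) (here (old∈B q q-old))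
    ... | no p-old | yes (j , refl) =
      1 , s≤s z≤n , step (old∈B p p-old) (inj₁ (inj₁ (toℕ-y⁻ , p , refl , p→q))) (here (y⁻∈B j))
    ... | yes (i , refl) | no q-old =
      walk≤-weaken 3t+1≤4t (walk≤-++ (climb-P i y⁺ (y⁺∈B i))
        (1 , ≤-refl , step (y⁺∈B i) y⁺~q (here (old∈B q q-old))))
      where
      y⁺~q : RAdj X (P i y⁺) (inj₁ (top m q))
      y⁺~q = inj₂ (inj₂ (inj₂ (trans toℕ-y⁺ (sym 2t∸6≡4+2u) , q , refl , p→q)))
      3t+1≤4t : 3 * t + 1 ≤ 4 * t
      3t+1≤4t = m+k≡n⇒m≤n (4 + u) (slack u)
        where
        slack : ∀ u → 3 * (5 + u) + 1 + (4 + u) ≡ 4 * (5 + u)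
        slack = ℕ-Solver.solve-∀
    ... | yes (i , refl) | yes (j , refl) = contradiction (inj₁ (CycSucc⇒ET m p→q)) (stable i j)

    forward-walk : ∀ n p q → + toℕ p ℤ.+ + n ≡ + toℕ q mod L → RawWalk≤ (anchor p) (anchor q) (n * (4 * t))
    forward-walk zero p q p≡q = 0 , z≤n , subst (λ q → RawWalk (anchor p) (anchor q) 0) p≡q′ (here (anchor∈B p))
      where
      p≡q′ : p ≡ q
      p≡q′ = Finₚ.toℕ-injective (≡mod⇒≡ (Finₚ.toℕ<n p) (Finₚ.toℕ<n q)
                (≡mod-trans (≡⇒≡mod (sym (ℤₚ.+-identityʳ (+ toℕ p)))) p≡q))
    forward-walk (suc n) p q p+1+n≡q with CycSucc-next p
    ... | p′ , p→p′ = walk≤-++ (anchor-step p→p′) (forward-walk n p′ q p′+n≡q)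
      where
      regroup : (+ toℕ p ℤ.+ 1ℤ) ℤ.+ + n ≡ + toℕ p ℤ.+ + suc n
      regroup = trans (ℤₚ.+-assoc (+ toℕ p) 1ℤ (+ n)) (cong (ℤ._+_ (+ toℕ p)) (sym (ℤₚ.pos-+ 1 n)))
      p′+n≡q : + toℕ p′ ℤ.+ + n ≡ + toℕ q mod L
      p′+n≡q = ≡mod-trans (≡mod-+ʳ (+ n) (≡mod-sym (CycSucc⇒≡mod p→p′)))
                 (≡mod-trans (≡⇒≡mod regroup) p+1+n≡q)

    near⇒anchor-walk : ∀ {D p q} → Near L D (toℕ p) (toℕ q) → RawWalk≤ (anchor p) (anchor q) (D * (4 * t))
    near⇒anchor-walk {p = p} {q} (+ n , n≤D , p+n≡q) =
      walk≤-weaken (*-monoˡ-≤ (4 * t) n≤D) (forward-walk n p q p+n≡q)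
    near⇒anchor-walk {p = p} {q} (-[1+ n ] , n<D , p-n≡q) =
      walk≤-weaken (*-monoˡ-≤ (4 * t) n<D) (walk≤-reverse (forward-walk (suc n) q p (≡mod-move -[1+ n ] p-n≡q)))

    position : (v : V′) → InB′ v → Fin L
    position (inj₁ _)       ((q , _) , _) = q
    position (inj₂ (i , _)) _             = pos i

    shadow-position : ∀ v v∈B → shadowˣ v ≡ toℕ (position v v∈B)
    shadow-position (inj₁ _) ((q , refl) , _) = shadow-top m q
    shadow-position (inj₂ _) _                = refl

    depth-B : ∀ v → InB′ v → depthˣ v ≡ 0
    depth-B (inj₁ _) ((q , refl) , _) = depth-top m q
    depth-B (inj₂ _) _                = refl

    anchor-walk : ∀ v v∈B → RawWalk≤ (anchor (position v v∈B)) v (3 * t)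
    anchor-walk (inj₁ _) v∈B@((q , refl) , not-x) =
      subst (λ a → RawWalk≤ a (inj₁ (top m q)) (3 * t))
            (sym (anchor-old q λ (i , xᵢ≡q) → not-x i (cong (top m) (sym xᵢ≡q))))
            (0 , z≤n , here v∈B)
    anchor-walk (inj₂ (i , inj₁ a)) a∈B =
      subst (λ w → RawWalk≤ w (P i a) (3 * t)) (sym (anchor-x i)) (climb-P i a a∈B)
    anchor-walk (inj₂ (i , inj₂ (e , b))) _ =
      subst (λ w → RawWalk≤ w (Q i e b) (3 * t)) (sym (anchor-x i)) (climb-Q i e b)

    B-walk : ∀ {v w D} v∈B w∈B → Near L D (toℕ (position v v∈B)) (toℕ (position w w∈B)) →
      RawWalk≤ v w (3 * t + (D * (4 * t) + 3 * t))
    B-walk {v} {w} v∈B w∈B near =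
      walk≤-++ (walk≤-reverse (anchor-walk v v∈B)) (walk≤-++ (near⇒anchor-walk near) (anchor-walk w w∈B))

    module Realisation (Θ : Territory) (φ : Iso (Territory.T Θ) X)
             (B⇔B′ : ∀ v → Territory.InB Θ v ⇔ InB′ (Iso.f φ v)) where
      open Territory Θ using (T; InB)
      open Iso φ
      open Equivalence using (to; from)

      B⇒B′ : ∀ {v} → InB v → InB′ (f v)
      B⇒B′ {v} = to (B⇔B′ v)

      positions-near : ∀ {x y n} (x∈B : InB x) (y∈B : InB y) → Walk T Everything x y n →
        Near L ((t ∸ 3) ^ n) (toℕ (position (f x) (B⇒B′ x∈B))) (toℕ (position (f y) (B⇒B′ y∈B)))
      positions-near {x} {y} {n} x∈B y∈B w =
        subst₂ (Near L ((t ∸ 3) ^ n)) (shadow-position (f x) (B⇒B′ x∈B)) (shadow-position (f y) (B⇒B′ y∈B))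
               shadows-near
        where
        shadows-near : Near L ((t ∸ 3) ^ n) (shadowˣ (f x)) (shadowˣ (f y))
        shadows-near =
          subst (λ d → Near L ((t ∸ 3) ^ (d + n)) (shadowˣ (f x)) (shadowˣ (f y))) (depth-B (f y) (B⇒B′ y∈B))
                (proj₂ (walk⇒near (s≤s (s≤s z≤n)) depthˣ shadowˣ (λ {v} {w} → RAdj⇒LayerStep {v} {w})
                                  (walk⇒raw φ (λ _ _ → tt) w)))

      B′-walk⇒B-walk : ∀ {x y n} → RawWalk≤ (f x) (f y) n → DistLe T InB x y n
      B′-walk⇒B-walk {x} {y} (l , l≤n , w) =
        l , l≤n , subst₂ (λ a b → Walk T InB a b l) (g∘f x) (g∘f y) (raw⇒walk φ B′⇒B w)
        where
        B′⇒B : ∀ w → InB′ w → InB (g w)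
        B′⇒B w w∈B′ = from (B⇔B′ (g w)) (subst InB′ (sym (f∘g w)) w∈B′)

  budget : ∀ d → 3 * t + (t ^ d * (4 * t) + 3 * t) ≤ t ^ (d + 3 * t)
  budget d = begin
    3 * t + (x * (4 * t) + 3 * t)             ≤⟨ +-mono-≤ 3t≤x*3t (+-monoʳ-≤ (x * (4 * t)) 3t≤x*3t) ⟩
    x * (3 * t) + (x * (4 * t) + x * (3 * t)) ≡⟨ collect x u ⟩
    x * (10 * t)                              ≤⟨ *-monoʳ-≤ x (m+k≡n⇒m≤n _ (slack u)) ⟩
    x * t ^ 3                                 ≤⟨ *-monoʳ-≤ x (^-monoʳ-≤ t (m≤m*n 3 t)) ⟩
    x * t ^ (3 * t)                           ≡⟨ ^-distribˡ-+-* t d (3 * t) ⟨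
    t ^ (d + 3 * t)                           ∎
    where
    open ≤-Reasoning
    x = t ^ d
    3t≤x*3t : 3 * t ≤ x * (3 * t)
    3t≤x*3t = subst (_≤ x * (3 * t)) (*-identityˡ (3 * t)) (*-monoˡ-≤ (3 * t) (^-monoʳ-≤ t {0} {d} z≤n))
    collect : ∀ x u → x * (3 * (5 + u)) + (x * (4 * (5 + u)) + x * (3 * (5 + u))) ≡ x * (10 * (5 + u))
    collect = ℕ-Solver.solve-∀
    slack : ∀ u → 10 * (5 + u) + (75 + 65 * u + 15 * (u * u) + u * (u * u)) ≡ (5 + u) * ((5 + u) * ((5 + u) * 1))
    slack = ℕ-Solver.solve-∀

theorem3p3 : (t : ℕ) → 5 ≤ t → (d : ℕ) → 1 ≤ d → (Θ : Territory) →
    Construction.Canonical t Θ →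
    (x y : Graph.V (Territory.T Θ)) → Territory.InB Θ x → Territory.InB Θ y →
    DistLe (Territory.T Θ) Everything x y d →
    DistLe (Territory.T Θ) (Territory.InB Θ) x y (t ^ (d + 3 * t))
theorem3p3 _ (s≤s (s≤s (s≤s (s≤s (s≤s (z≤n {u})))))) d _ Θ (m , D , φ , B⇔B′) x y x∈B y∈B (n , n≤d , w) =
  B′-walk⇒B-walk (walk≤-weaken (budget d) (B-walk _ _ (near-weaken shadow-bound (positions-near x∈B y∈B w))))
  where
  open Bounds u
  open Expansion-of m D
  open Realisation Θ φ B⇔B′
  open RawWalks X InB′
  shadow-bound : (t ∸ 3) ^ n ≤ t ^ d
  shadow-bound = ≤-trans (^-monoˡ-≤ n (m∸n≤m t 3)) (^-monoʳ-≤ t n≤d)
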